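{- Let $r\ge1$ be an integer, $p=2^{ -r}$, and let $\mu_p$ be the distribution on $\{0,1\}$ with $\mu_p(1)=p$. Then $(\{0,1\},\mu_p)$ can be $r$-locally embedded.
   Context: A distribution $(D,\mu_1)$ on a finite totally ordered set $D$ (here $D=\{0,1\}$ with $0<1$) can be $r$-locally embedded if there exist $\phi\colon\{0,1\}^r\to D$, maps $\Psi_\omega\colon D\to\{0,1\}^r$ ($\omega\in\Omega$) and a probability distribution $P$ on $\Omega$ such that: $\phi$ and all $\Psi_\omega$ are monotone (w.r.t. the coordinatewise order on $\{0,1\}^r$); $\phi(x)\sim\mu_1$ when $x$ is uniform on $\{0,1\}^r$; $\Psi_\omega(y)$ is uniform on $\{0,1\}^r$ when $y\sim\mu_1$ and $\omega\sim P$ independently; and $\phi\circ\Psi_\omega$ is the identity for each $\omega$. -}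

module Defs where

open import Data.Bool using (Bool; true; false; if_then_else_) renaming (_≤_ to _≤ᵇ_; _≟_ to _≟ᵇ_)
open import Data.Nat using (ℕ; zero; suc)
open import Data.Fin using (Fin)
open import Data.List using (List; []; _∷_; map; _++_; foldr)
open import Data.Vec using (Vec; []; _∷_)
open import Data.Vec.Properties using (≡-dec)
open import Data.Vec.Relation.Binary.Pointwise.Inductive using (Pointwise)
open import Data.Rational using (ℚ; 0ℚ; 1ℚ; ½; _+_; _*_; _≤_)
open import Data.Product using (Σ; _×_; _,_)
open import Relation.Nullary.Decidable using (⌊_⌋)
open import Relation.Binary.PropositionalEquality using (_≡_)

-- All elements of {0,1}^r  (false = 0, true = 1).
allBits : (r : ℕ) → List (Vec Bool r)
allBits zero    = [] ∷ []
allBits (suc r) = map (false ∷_) (allBits r) ++ map (true ∷_) (allBits r)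

sumℚ : List ℚ → ℚ
sumℚ = foldr _+_ 0ℚ

allFinL : (m : ℕ) → List (Fin m)
allFinL m = Data.List.allFin m

eqVec : {r : ℕ} → Vec Bool r → Vec Bool r → ℚ
eqVec x y = if ⌊ ≡-dec _≟ᵇ_ x y ⌋ then 1ℚ else 0ℚ

eqBool : Bool → Bool → ℚ
eqBool a b = if ⌊ a ≟ᵇ b ⌋ then 1ℚ else 0ℚ

_≤ᵛ_ : {r : ℕ} → Vec Bool r → Vec Bool r → Set
_≤ᵛ_ = Pointwise _≤ᵇ_

halfPow : ℕ → ℚ
halfPow zero    = 1ℚ
halfPow (suc r) = ½ * halfPow r

μ : ℚ → Bool → ℚ
μ p true  = p
μ p false = Data.Rational._-_ 1ℚ p

MonotoneΦ : {r : ℕ} → (Vec Bool r → Bool) → Set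
MonotoneΦ φ = ∀ x y → x ≤ᵛ y → φ x ≤ᵇ φ y

MonotoneΨ : {r : ℕ} → (Bool → Vec Bool r) → Set
MonotoneΨ Ψ = ∀ a b → a ≤ᵇ b → Ψ a ≤ᵛ Ψ b

IsProb : (m : ℕ) → (Fin m → ℚ) → Set
IsProb m P = (∀ ω → 0ℚ ≤ P ω) × (sumℚ (map P (allFinL m)) ≡ 1ℚ)

-- ({0,1}, μ₁) can be r-locally embedded (Ω finite, P with rational weights).
LocallyEmbeddable : (r : ℕ) → (Bool → ℚ) → Set
LocallyEmbeddable r μ₁ =
  Σ (Vec Bool r → Bool) λ φ →
  Σ ℕ λ m →
  Σ (Fin m → Bool → Vec Bool r) λ Ψ →
  Σ (Fin m → ℚ) λ P →
      IsProb m P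
    × MonotoneΦ φ
    × (∀ ω → MonotoneΨ (Ψ ω))
    -- φ(x) ~ μ₁ for x uniform on {0,1}^r
    × (∀ d → sumℚ (map (λ x → halfPow r * eqBool (φ x) d) (allBits r)) ≡ μ₁ d)
    -- Ψ_ω(y) uniform on {0,1}^r for y ~ μ₁, ω ~ P independent
    × (∀ x → sumℚ (map (λ ω → sumℚ (map (λ y → P ω * μ₁ y * eqVec (Ψ ω y) x)
                                         (true ∷ false ∷ [])))
                       (allFinL m)) ≡ halfPow r)
    × (∀ ω y → φ (Ψ ω y) ≡ y)

{-# OPTIONS --safe #-}
module Submission where

-- Take φ to be the conjunction of the r bits, so that φ⁻¹(1) is the single all-ones vector,
-- which has mass 2⁻ʳ = p under the uniform distribution.  Let Ω be the set of the other
-- 2ʳ − 1 vectors with the uniform distribution, and let Ψ_ω send 1 to the all-ones vector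
-- and 0 to ω.  Then Ψ_ω(y) is the all-ones vector with probability p and every other
-- vector with probability (1 − p)/(2ʳ − 1) = 2⁻ʳ, i.e. it is uniform.

open import Defs
open import Data.Bool using (Bool; true; false; _∧_) renaming (_≤_ to _≤ᵇ_)
import Data.Bool as Bool
open import Data.Bool.Properties using (≤-minimum; ≤-maximum) renaming (≤-refl to ≤ᵇ-refl)
open import Data.Fin using (Fin)
open import Data.List using (List; []; _∷_; map; _++_; length; lookup; tabulate)
open import Data.List.Properties using (map-++; map-∘; map-cong; map-cong-local; map-tabulate; tabulate-lookup)
import Data.List.Relation.Unary.All as All
open import Data.List.Relation.Unary.All.Properties using (++⁺; map⁺)
open import Data.List.Membership.Propositional.Properties using (∈-lookup)
open import Data.Nat using (ℕ; zero; suc; _≥_)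
open import Data.Rational using (ℚ; 0ℚ; 1ℚ; ½; _+_; _*_; _-_; 1/_; NonZero; Positive; NonNegative)
open import Data.Rational.Properties
  using (+-identityˡ; +-identityʳ; +-assoc; *-identityʳ; *-zeroˡ; *-zeroʳ; *-distribˡ-+; *-inverseˡ;
         pos⇒nonZero; pos⇒nonNeg; pos+nonNeg⇒pos; 1/pos⇒pos; nonNegative⁻¹)
open import Data.Rational.Solver using (module +-*-Solver)
open import Data.Vec using (Vec; []; _∷_; replicate)
open import Data.Vec.Properties using (≡-dec)
import Data.Vec.Relation.Binary.Pointwise.Inductive as Pointwise
open import Data.Product using (_,_)
open import Function using (id)
open import Relation.Binary.PropositionalEquality using (_≡_; refl; sym; trans; cong; cong₂; subst; module ≡-Reasoning)
open import Relation.Nullary using (yes; no)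

open +-*-Solver using (solve; _:=_; _:+_; _:*_; _:-_; con)
open ≡-Reasoning

private
  variable
    A : Set
    r : ℕ

sumℚ-++ : (xs ys : List ℚ) → sumℚ (xs ++ ys) ≡ sumℚ xs + sumℚ ys
sumℚ-++ []       ys = sym (+-identityˡ _)
sumℚ-++ (x ∷ xs) ys = trans (cong (x +_) (sumℚ-++ xs ys)) (sym (+-assoc x _ _))

sumℚ-cong : {f g : A → ℚ} → (∀ x → f x ≡ g x) → (xs : List A) → sumℚ (map f xs) ≡ sumℚ (map g xs)
sumℚ-cong f≗g xs = cong sumℚ (map-cong f≗g xs)

sumℚ-+ : (f g : A → ℚ) (xs : List A) →
         sumℚ (map (λ x → f x + g x) xs) ≡ sumℚ (map f xs) + sumℚ (map g xs)
sumℚ-+ f g []       = refl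
sumℚ-+ f g (x ∷ xs) = trans (cong (f x + g x +_) (sumℚ-+ f g xs))
  (solve 4 (λ a b s t → (a :+ b) :+ (s :+ t) := (a :+ s) :+ (b :+ t)) refl (f x) (g x) _ _)

sumℚ-*ˡ : (k : ℚ) (f : A → ℚ) (xs : List A) → sumℚ (map (λ x → k * f x) xs) ≡ k * sumℚ (map f xs)
sumℚ-*ˡ k f []       = sym (*-zeroʳ k)
sumℚ-*ˡ k f (x ∷ xs) = trans (cong (k * f x +_) (sumℚ-*ˡ k f xs)) (sym (*-distribˡ-+ k (f x) _))

card : List A → ℚ
card xs = sumℚ (map (λ _ → 1ℚ) xs)

card-nonNeg : (xs : List A) → NonNegative (card xs)
card-nonNeg []       = _
card-nonNeg (x ∷ xs) = pos⇒nonNeg (1ℚ + card xs) {{pos+nonNeg⇒pos 1ℚ (card xs) {{card-nonNeg xs}}}}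

sumℚ-const : (k : ℚ) (xs : List A) → sumℚ (map (λ _ → k) xs) ≡ k * card xs
sumℚ-const k xs = trans (sumℚ-cong (λ _ → sym (*-identityʳ k)) xs) (sumℚ-*ˡ k (λ _ → 1ℚ) xs)

sumℚ-lookup : (f : A → ℚ) (xs : List A) →
              sumℚ (map (λ i → f (lookup xs i)) (allFinL (length xs))) ≡ sumℚ (map f xs)
sumℚ-lookup f xs = cong sumℚ (begin
  map (λ i → f (lookup xs i)) (allFinL (length xs)) ≡⟨ map-tabulate id _ ⟩
  tabulate (λ i → f (lookup xs i))                  ≡⟨ map-tabulate (lookup xs) f ⟨
  map f (tabulate (lookup xs))                      ≡⟨ cong (map f) (tabulate-lookup xs) ⟩
  map f xs                                          ∎)

ones : (r : ℕ) → Vec Bool r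
ones r = replicate r true

nonOnes : (r : ℕ) → List (Vec Bool r)
nonOnes zero    = []
nonOnes (suc r) = map (false ∷_) (allBits r) ++ map (true ∷_) (nonOnes r)

sumℚ-cons-halves : (f : Vec Bool (suc r) → ℚ) (xs ys : List (Vec Bool r)) →
                   sumℚ (map f (map (false ∷_) xs ++ map (true ∷_) ys))
                     ≡ sumℚ (map (λ x → f (false ∷ x)) xs) + sumℚ (map (λ x → f (true ∷ x)) ys)
sumℚ-cons-halves f xs ys = begin
  sumℚ (map f (map (false ∷_) xs ++ map (true ∷_) ys))
    ≡⟨ cong sumℚ (map-++ f (map (false ∷_) xs) _) ⟩
  sumℚ (map f (map (false ∷_) xs) ++ map f (map (true ∷_) ys))
    ≡⟨ sumℚ-++ (map f (map (false ∷_) xs)) _ ⟩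
  sumℚ (map f (map (false ∷_) xs)) + sumℚ (map f (map (true ∷_) ys))
    ≡⟨ cong₂ _+_ (cong sumℚ (map-∘ xs)) (cong sumℚ (map-∘ ys)) ⟨
  sumℚ (map (λ x → f (false ∷ x)) xs) + sumℚ (map (λ x → f (true ∷ x)) ys) ∎

sumℚ-allBits : (r : ℕ) (f : Vec Bool r → ℚ) → sumℚ (map f (allBits r)) ≡ f (ones r) + sumℚ (map f (nonOnes r))
sumℚ-allBits zero    f = refl
sumℚ-allBits (suc r) f = begin
  sumℚ (map f (allBits (suc r)))
    ≡⟨ sumℚ-cons-halves f (allBits r) (allBits r) ⟩
  s₀ + sumℚ (map (λ x → f (true ∷ x)) (allBits r))
    ≡⟨ cong (s₀ +_) (sumℚ-allBits r (λ x → f (true ∷ x))) ⟩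
  s₀ + (f (ones (suc r)) + s₁)
    ≡⟨ solve 3 (λ a b c → a :+ (b :+ c) := b :+ (a :+ c)) refl s₀ (f (ones (suc r))) s₁ ⟩
  f (ones (suc r)) + (s₀ + s₁)
    ≡⟨ cong (f (ones (suc r)) +_) (sumℚ-cons-halves f (allBits r) (nonOnes r)) ⟨
  f (ones (suc r)) + sumℚ (map f (nonOnes (suc r))) ∎
  where
  s₀ = sumℚ (map (λ x → f (false ∷ x)) (allBits r))
  s₁ = sumℚ (map (λ x → f (true ∷ x)) (nonOnes r))

card-allBits : (r : ℕ) → card (allBits r) ≡ 1ℚ + card (nonOnes r)
card-allBits r = sumℚ-allBits r (λ _ → 1ℚ)

halfPow-card-allBits : (r : ℕ) → halfPow r * card (allBits r) ≡ 1ℚ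
halfPow-card-allBits zero    = refl
halfPow-card-allBits (suc r) = begin
  ½ * q * card (allBits (suc r))
    ≡⟨ cong (½ * q *_) (sumℚ-cons-halves (λ _ → 1ℚ) (allBits r) (allBits r)) ⟩
  ½ * q * (card (allBits r) + card (allBits r))
    ≡⟨ solve 2 (λ q n → con ½ :* q :* (n :+ n) := (con ½ :+ con ½) :* (q :* n)) refl q _ ⟩
  (½ + ½) * (q * card (allBits r))
    ≡⟨ cong ((½ + ½) *_) (halfPow-card-allBits r) ⟩
  1ℚ ∎
  where q = halfPow r

halfPow-card-nonOnes : (r : ℕ) → halfPow r * card (nonOnes r) ≡ 1ℚ - halfPow r
halfPow-card-nonOnes r = begin
  q * m                    ≡⟨ solve 2 (λ q m → q :* m := q :* (con 1ℚ :+ m) :- q) refl q m ⟩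
  q * (1ℚ + m) - q         ≡⟨ cong (λ n → q * n - q) (card-allBits r) ⟨
  q * card (allBits r) - q ≡⟨ cong (_- q) (halfPow-card-allBits r) ⟩
  1ℚ - q                   ∎
  where
  q = halfPow r
  m = card (nonOnes r)

card-nonOnes-pos : (r : ℕ) → Positive (card (nonOnes (suc r)))
card-nonOnes-pos r = subst Positive (sym card-split)
  (pos+nonNeg⇒pos (1ℚ + m) {{pos+nonNeg⇒pos 1ℚ m {{card-nonNeg (nonOnes r)}}}} m {{card-nonNeg (nonOnes r)}})
  where
  m = card (nonOnes r)
  card-split : card (nonOnes (suc r)) ≡ (1ℚ + m) + m
  card-split = trans (sumℚ-cons-halves (λ _ → 1ℚ) (allBits r) (nonOnes r))
                     (cong (_+ m) (card-allBits r))

eqVec-∷ : (a b : Bool) (y x : Vec Bool r) → eqVec (a ∷ y) (b ∷ x) ≡ eqBool a b * eqVec y x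
eqVec-∷ false true  y x = sym (*-zeroˡ (eqVec y x))
eqVec-∷ true  false y x = sym (*-zeroˡ (eqVec y x))
eqVec-∷ false false y x with ≡-dec Bool._≟_ y x
... | yes _ = refl
... | no  _ = refl
eqVec-∷ true  true  y x with ≡-dec Bool._≟_ y x
... | yes _ = refl
... | no  _ = refl

sumℚ-eqVec : (x : Vec Bool r) → sumℚ (map (λ y → eqVec y x) (allBits r)) ≡ 1ℚ
sumℚ-eqVec []      = refl
sumℚ-eqVec (b ∷ x) = begin
  sumℚ (map (λ y → eqVec y (b ∷ x)) (allBits _))
    ≡⟨ sumℚ-cons-halves (λ y → eqVec y (b ∷ x)) (allBits _) (allBits _) ⟩
  sumℚ (map (λ y → eqVec (false ∷ y) (b ∷ x)) (allBits _)) + sumℚ (map (λ y → eqVec (true ∷ y) (b ∷ x)) (allBits _))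
    ≡⟨ cong₂ _+_ (half false) (half true) ⟩
  eqBool false b * 1ℚ + eqBool true b * 1ℚ
    ≡⟨ eqBool-partition b ⟩
  1ℚ ∎
  where
  half : (a : Bool) → sumℚ (map (λ y → eqVec (a ∷ y) (b ∷ x)) (allBits _)) ≡ eqBool a b * 1ℚ
  half a = trans (sumℚ-cong (λ y → eqVec-∷ a b y x) (allBits _))
                 (trans (sumℚ-*ˡ (eqBool a b) (λ y → eqVec y x) (allBits _))
                        (cong (eqBool a b *_) (sumℚ-eqVec x)))
  eqBool-partition : (b : Bool) → eqBool false b * 1ℚ + eqBool true b * 1ℚ ≡ 1ℚ
  eqBool-partition false = refl
  eqBool-partition true  = refl

and : Vec Bool r → Bool
and []      = true
and (b ∷ x) = b ∧ and x

∧-mono-≤ : {a b c d : Bool} → a ≤ᵇ b → c ≤ᵇ d → (a ∧ c) ≤ᵇ (b ∧ d)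
∧-mono-≤ {false} {b} {c} {d} _ _ = ≤-minimum (b ∧ d)
∧-mono-≤ {true}  {true}      _ c≤d = c≤d

and-mono : MonotoneΦ (and {r})
and-mono []      []      Pointwise.[]            = ≤ᵇ-refl
and-mono (a ∷ x) (b ∷ y) (a≤b Pointwise.∷ x≤y) = ∧-mono-≤ a≤b (and-mono x y x≤y)

and-ones : (r : ℕ) → and (ones r) ≡ true
and-ones zero    = refl
and-ones (suc r) = and-ones r

and-nonOnes : (r : ℕ) → All.All (λ x → and x ≡ false) (nonOnes r)
and-nonOnes zero    = All.[]
and-nonOnes (suc r) = ++⁺ (map⁺ (All.universal (λ _ → refl) (allBits r))) (map⁺ (and-nonOnes r))

sumℚ-allBits-and : (r : ℕ) (d : Bool) →
  sumℚ (map (λ x → eqBool (and x) d) (allBits r)) ≡ eqBool true d + eqBool false d * card (nonOnes r)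
sumℚ-allBits-and r d = begin
  sumℚ (map (λ x → eqBool (and x) d) (allBits r))
    ≡⟨ sumℚ-allBits r (λ x → eqBool (and x) d) ⟩
  eqBool (and (ones r)) d + sumℚ (map (λ x → eqBool (and x) d) (nonOnes r))
    ≡⟨ cong₂ _+_ (cong (λ b → eqBool b d) (and-ones r)) (cong sumℚ (map-cong-local on-nonOnes)) ⟩
  eqBool true d + sumℚ (map (λ _ → eqBool false d) (nonOnes r))
    ≡⟨ cong (eqBool true d +_) (sumℚ-const (eqBool false d) (nonOnes r)) ⟩
  eqBool true d + eqBool false d * card (nonOnes r) ∎
  where
  on-nonOnes : All.All (λ x → eqBool (and x) d ≡ eqBool false d) (nonOnes r)
  on-nonOnes = All.map (cong (λ b → eqBool b d)) (and-nonOnes r)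

and-distribution : (r : ℕ) (d : Bool) →
  sumℚ (map (λ x → halfPow r * eqBool (and x) d) (allBits r)) ≡ μ (halfPow r) d
and-distribution r d = trans (sumℚ-*ˡ q (λ x → eqBool (and x) d) (allBits r))
                             (trans (cong (q *_) (sumℚ-allBits-and r d)) (by-value d))
  where
  q = halfPow r
  m = card (nonOnes r)
  by-value : (d : Bool) → q * (eqBool true d + eqBool false d * m) ≡ μ q d
  by-value true  = solve 2 (λ q m → q :* (con 1ℚ :+ con 0ℚ :* m) := q) refl q m
  by-value false = trans (solve 2 (λ q m → q :* (con 0ℚ :+ con 1ℚ :* m) := q :* m) refl q m)
                         (halfPow-card-nonOnes r)

embed : (r : ℕ) → Fin (length (nonOnes r)) → Bool → Vec Bool r
embed r ω false = lookup (nonOnes r) ω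
embed r ω true  = ones r

≤ᵛ-ones : (x : Vec Bool r) → x ≤ᵛ ones r
≤ᵛ-ones []      = Pointwise.[]
≤ᵛ-ones (b ∷ x) = ≤-maximum b Pointwise.∷ ≤ᵛ-ones x

embed-mono : (r : ℕ) (ω : Fin (length (nonOnes r))) → MonotoneΨ (embed r ω)
embed-mono r ω false false _ = Pointwise.refl ≤ᵇ-refl
embed-mono r ω false true  _ = ≤ᵛ-ones _
embed-mono r ω true  true  _ = Pointwise.refl ≤ᵇ-refl

and-embed : (r : ℕ) (ω : Fin (length (nonOnes r))) (y : Bool) → and (embed r ω y) ≡ y
and-embed r ω false = All.lookup (and-nonOnes r) (∈-lookup ω)
and-embed r ω true  = and-ones r

card-nonOnes-nonZero : (r : ℕ) → NonZero (card (nonOnes (suc r)))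
card-nonOnes-nonZero r = pos⇒nonZero (card (nonOnes (suc r))) {{card-nonOnes-pos r}}

uniformWeight : (r : ℕ) → ℚ
uniformWeight r = (1/ card (nonOnes (suc r))) {{card-nonOnes-nonZero r}}

uniformWeight-*-card : (r : ℕ) → uniformWeight r * card (nonOnes (suc r)) ≡ 1ℚ
uniformWeight-*-card r = *-inverseˡ (card (nonOnes (suc r))) {{card-nonOnes-nonZero r}}

uniform-isProb : (r : ℕ) → IsProb (length (nonOnes (suc r))) (λ _ → uniformWeight r)
uniform-isProb r = (λ _ → nonNegative⁻¹ c {{c-nonNeg}}) , sum-one
  where
  c = uniformWeight r
  c-nonNeg : NonNegative c
  c-nonNeg = pos⇒nonNeg c {{1/pos⇒pos (card (nonOnes (suc r))) {{card-nonOnes-pos r}}}}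
  sum-one : sumℚ (map (λ _ → c) (allFinL (length (nonOnes (suc r))))) ≡ 1ℚ
  sum-one = trans (sumℚ-lookup (λ _ → c) (nonOnes (suc r)))
                  (trans (sumℚ-const c (nonOnes (suc r))) (uniformWeight-*-card r))

embed-uniform : (r : ℕ) (x : Vec Bool (suc r)) →
  sumℚ (map (λ ω → sumℚ (map (λ y → uniformWeight r * μ (halfPow (suc r)) y * eqVec (embed (suc r) ω y) x) (true ∷ false ∷ [])))
            (allFinL (length (nonOnes (suc r)))))
    ≡ halfPow (suc r)
embed-uniform r x = begin
  sumℚ (map (λ ω → c * q * e + (c * (1ℚ - q) * eqVec (lookup ys ω) x + 0ℚ)) (allFinL (length ys)))
    ≡⟨ sumℚ-lookup (λ y → c * q * e + (c * (1ℚ - q) * eqVec y x + 0ℚ)) ys ⟩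
  sumℚ (map (λ y → c * q * e + (c * (1ℚ - q) * eqVec y x + 0ℚ)) ys)
    ≡⟨ sumℚ-cong (λ y → cong (c * q * e +_) (+-identityʳ _)) ys ⟩
  sumℚ (map (λ y → c * q * e + c * (1ℚ - q) * eqVec y x) ys)
    ≡⟨ sumℚ-+ (λ _ → c * q * e) (λ y → c * (1ℚ - q) * eqVec y x) ys ⟩
  sumℚ (map (λ _ → c * q * e) ys) + sumℚ (map (λ y → c * (1ℚ - q) * eqVec y x) ys)
    ≡⟨ cong₂ _+_ (sumℚ-const (c * q * e) ys) (sumℚ-*ˡ (c * (1ℚ - q)) (λ y → eqVec y x) ys) ⟩
  c * q * e * card ys + c * (1ℚ - q) * sumℚ (map (λ y → eqVec y x) ys)
    ≡⟨ cong₂ (λ a b → a + b * sumℚ (map (λ y → eqVec y x) ys)) first-weight second-weight ⟩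
  q * e + q * sumℚ (map (λ y → eqVec y x) ys)
    ≡⟨ *-distribˡ-+ q e _ ⟨
  q * (e + sumℚ (map (λ y → eqVec y x) ys))
    ≡⟨ cong (q *_) (sumℚ-allBits (suc r) (λ y → eqVec y x)) ⟨
  q * sumℚ (map (λ y → eqVec y x) (allBits (suc r)))
    ≡⟨ cong (q *_) (sumℚ-eqVec x) ⟩
  q * 1ℚ
    ≡⟨ *-identityʳ q ⟩
  q ∎
  where
  q  = halfPow (suc r)
  ys = nonOnes (suc r)
  c  = uniformWeight r
  e  = eqVec (ones (suc r)) x
  first-weight : c * q * e * card ys ≡ q * e
  first-weight = trans (solve 4 (λ c q e n → c :* q :* e :* n := q :* e :* (c :* n)) refl c q e (card ys))
                       (trans (cong (q * e *_) (uniformWeight-*-card r)) (*-identityʳ (q * e)))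
  second-weight : c * (1ℚ - q) ≡ q
  second-weight = begin
    c * (1ℚ - q)      ≡⟨ cong (c *_) (halfPow-card-nonOnes (suc r)) ⟨
    c * (q * card ys) ≡⟨ solve 3 (λ c q n → c :* (q :* n) := q :* (c :* n)) refl c q (card ys) ⟩
    q * (c * card ys) ≡⟨ cong (q *_) (uniformWeight-*-card r) ⟩
    q * 1ℚ            ≡⟨ *-identityʳ q ⟩
    q                 ∎

lemma2p1 : (r : ℕ) → r ≥ 1 → LocallyEmbeddable r (μ (halfPow r))
lemma2p1 (suc r) _ =
  and , length (nonOnes (suc r)) , embed (suc r) , (λ _ → uniformWeight r) ,
  uniform-isProb r , and-mono , embed-mono (suc r) , and-distribution (suc r) ,
  embed-uniform r , and-embed (suc r)
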